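{- Let $q$ be a prime power, let $m\ge1$, $s\ge1$ and $u\ge0$ be integers, and let $\mathbf{e}\in\mathbb{N}^s$. A digital net over $\mathbb{F}_q$ with $m\times m$ generating matrices $C_1,\dots,C_s$ over $\mathbb{F}_q$ is a digital $(u,m,\mathbf{e},s)$-net over $\mathbb{F}_q$ if and only if the system $\{\mathbf{c}^{(i)}_j\in\mathbb{F}_q^m:1\le i\le s,\ 1\le j\le m\}$ of row vectors of $C_1,\dots,C_s$ (where $\mathbf{c}^{(i)}_j$ is the $j$th row of $C_i$) is an $(m-u,m,\mathbf{e},s)$-system over $\mathbb{F}_q$.
   Context: $\mathbb{N}$ denotes the positive integers. For integers $0\le d\le m$ and $\mathbf{e}=(e_1,\dots,e_s)\in\mathbb{N}^s$, a system $\{\mathbf{a}^{(i)}_j\in\mathbb{F}_q^m:1\le i\le s,1\le j\le m\}$ is a $(d,m,\mathbf{e},s)$-system over $\mathbb{F}_q$ if for any nonnegative integers $d_1,\dots,d_s$ with $e_i\mid d_i$ for all $i$ and $\sum_id_i\le d$, the vectors $\mathbf{a}^{(i)}_j$, $1\le j\le d_i$, $1\le i\le s$, are linearly independent over $\mathbb{F}_q$ (trivially true for $d=0$). An elementary interval in base $b$ is $J=\prod_{i=1}^s[a_ib^{ -d_i},(a_i+1)b^{ -d_i})$ with integers $d_i\ge0$, $0\le a_i<b^{d_i}$; for integers $0\le u\le m$, a set of $b^m$ points in $[0,1)^s$ is a $(u,m,\mathbf{e},s)$-net in base $b$ if every such $J$ with $\lambda_s(J)\ge b^{u-m}$ and $e_i\mid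 d_i$ for all $i$ contains exactly $b^m\lambda_s(J)$ points. Digital net over $\mathbb{F}_q$ with generating matrices $C_1,\dots,C_s$: with $Z_q=\{0,\dots,q-1\}$ and bijections $\eta_r:Z_q\to\mathbb{F}_q$ ($0\le r<m$), $\kappa_{i,j}:\mathbb{F}_q\to Z_q$, for $0\le n<q^m$ with base-$q$ digits $n_0,\dots,n_{m-1}$ put $(y^{(i)}_{n,1},\dots,y^{(i)}_{n,m})^\top=C_i(\eta_0(n_0),\dots,\eta_{m-1}(n_{m-1}))^\top$, $x_n^{(i)}=\sum_{j=1}^m\kappa_{i,j}(y^{(i)}_{n,j})q^{ -j}$; the points $(x_n^{(1)},\dots,x_n^{(s)})$, $0\le n<q^m$, form the digital net, which is a digital $(u,m,\mathbf{e},s)$-net over $\mathbb{F}_q$ if it is a $(u,m,\mathbf{e},s)$-net in base $q$. -}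

module Defs where

open import Level using (Level; _⊔_) renaming (zero to 0ℓ)
open import Algebra.Bundles using (CommutativeRing)
open import Data.Nat using (ℕ; zero; suc; _+_; _*_; _∸_; _^_; _≤_; _<_; NonZero)
open import Data.Nat.Properties using (_≤?_; _<?_; m^n≢0)
open import Data.Nat.Divisibility using (_∣_)
open import Data.Nat.DivMod using (_/_; _mod_)
open import Data.Nat.Primality using (Prime)
open import Data.Fin using (Fin; toℕ)
import Data.Fin as F
open import Data.Fin.Properties using (all?)
open import Data.List using (List; length; filter; allFin)
open import Data.Product using (Σ; _×_)
open import Relation.Nullary using (¬_)
open import Relation.Nullary.Decidable using (_×-dec_)
open import Relation.Binary.PropositionalEquality as ≡ using (_≡_)
open import Function using (_∘_)
open import Function.Bundles using (Bijection)

IsPrimePower : ℕ → Set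
IsPrimePower q = Σ ℕ λ p → Σ ℕ λ k → Prime p × (1 ≤ k) × (q ≡ p ^ k)

Σℕ : ∀ {k} → (Fin k → ℕ) → ℕ
Σℕ {zero}  f = 0
Σℕ {suc k} f = f F.zero + Σℕ (f ∘ F.suc)

-- Fields (the standard library has no Field bundle): a commutative
-- ring with 0 ≠ 1 in which every nonzero element has an inverse.

record IsField {c ℓ} (R : CommutativeRing c ℓ) : Set (c ⊔ ℓ) where
  open CommutativeRing R using (Carrier; _≈_; 0#; 1#) renaming (_*_ to _*F_)
  field
    0≉1     : ¬ (0# ≈ 1#)
    inverse : ∀ x → ¬ (x ≈ 0#) → Σ Carrier λ y → (x *F y) ≈ 1#

HasCard : ∀ {c ℓ} → CommutativeRing c ℓ → ℕ → Set (c ⊔ ℓ)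
HasCard R q = Bijection (≡.setoid (Fin q)) (CommutativeRing.setoid R)

-- (u,m,e,s)-nets in base b, for point sets whose coordinates are of the
-- form X / b^m with X ∈ ℕ (all points of a digital net are of this form).
-- A point set of b^m points is given by P n i = b^m · (i-th coordinate
-- of the n-th point).  Membership of X / b^m in the elementary interval
-- [a b^-d , (a+1) b^-d) is  a·b^m ≤ X·b^d < (a+1)·b^m  (denominators
-- cleared).  λ_s(J) = b^-(Σ d_i); the condition λ_s(J) ≥ b^(u-m) is
-- b^(u + Σ d_i) ≤ b^m, and "contains exactly b^m λ_s(J) points" is
-- (#points in J) · b^(Σ d_i) = b^m (denominators cleared).

module _ (b m s : ℕ) where

  InInterval : (P : Fin (b ^ m) → Fin s → ℕ) (d a : Fin s → ℕ) → Fin (b ^ m) → Set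
  InInterval P d a n = ∀ i → (a i * b ^ m ≤ P n i * b ^ d i) × (P n i * b ^ d i < suc (a i) * b ^ m)

  countIn : (P : Fin (b ^ m) → Fin s → ℕ) (d a : Fin s → ℕ) → ℕ
  countIn P d a = length (filter (λ n → all? (λ i → (a i * b ^ m ≤? P n i * b ^ d i)
                                              ×-dec (P n i * b ^ d i <? suc (a i) * b ^ m)))
                                 (allFin (b ^ m)))

  IsNet : (u : ℕ) (e : Fin s → ℕ) (P : Fin (b ^ m) → Fin s → ℕ) → Set
  IsNet u e P =
    (d a : Fin s → ℕ) →
    (∀ i → a i < b ^ d i) →
    (∀ i → e i ∣ d i) →
    b ^ (u + Σℕ d) ≤ b ^ m →
    countIn P d a * b ^ Σℕ d ≡ b ^ m

module _ {c ℓ} (F : CommutativeRing c ℓ) where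
  open CommutativeRing F using (Carrier; _≈_; 0#; setoid) renaming (_*_ to _*F_; _+_ to _+F_)

  ΣF : ∀ {k} → (Fin k → Carrier) → Carrier
  ΣF {zero}  f = 0#
  ΣF {suc k} f = f F.zero +F ΣF (f ∘ F.suc)

  -- (d,m,e,s)-system: a i j is the vector a^(i)_(j+1) ∈ F^m.
  IsSystem : (d m s : ℕ) (e : Fin s → ℕ) (a : Fin s → Fin m → Fin m → Carrier) → Set (c ⊔ ℓ)
  IsSystem d m s e a =
    (dd : Fin s → ℕ) →
    (∀ i → e i ∣ dd i) →
    Σℕ dd ≤ d →
    (coef : Fin s → Fin m → Carrier) →
    (∀ i j → dd i ≤ toℕ j → coef i j ≈ 0#) →
    (∀ k → ΣF (λ i → ΣF (λ j → coef i j *F a i j k)) ≈ 0#) →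
    ∀ i j → toℕ j < dd i → coef i j ≈ 0#

  digit : (q : ℕ) .{{_ : NonZero q}} → ℕ → ℕ → Fin q
  digit q n r = (n / q ^ r) {{m^n≢0 q r}} mod q

  -- The digital net with generating matrices C i (C i j k = entry in
  -- row j, column k), bijections η r : Z_q → F and κ i j : F → Z_q.
  -- Returns q^m · x_n^(i) = Σ_{j=1}^m κ_{i,j}(y_{n,j}^(i)) q^(m-j).
  digitalNet : (q m s : ℕ) .{{_ : NonZero q}} →
               (C : Fin s → Fin m → Fin m → Carrier) →
               (η : Fin m → Bijection (≡.setoid (Fin q)) setoid) →
               (κ : Fin s → Fin m → Bijection setoid (≡.setoid (Fin q))) →
               Fin (q ^ m) → Fin s → ℕ
  digitalNet q m s C η κ n i =
    Σℕ (λ j → toℕ (Bijection.to (κ i j) (y j)) * q ^ (m ∸ suc (toℕ j)))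
    where
      y : Fin m → Carrier
      y j = ΣF (λ k → C i j k *F Bijection.to (η k) (digit q (toℕ n) (toℕ k)))

module Submission where

-- Fix exponents d = (d_1, …, d_s) with d_i ≤ m.  The n-th point of the net
-- lies in the elementary interval with lower corners a_i q^-d_i iff the
-- first d_i digits of its i-th coordinate spell a_i; through κ and η this
-- says that the vector v ∈ F^m of (η-images of) digits of n solves the
-- linear system  c^(i)_j · v = t_(i,j)  (j < d_i)  for a right-hand side t
-- determined by a, and every t arises from some a.  So counting points in
-- intervals is counting fibres of the linear map L_d : F^m → F^(Σ d_i)
-- whose rows are the first d_i rows of each C_i, and the theorem is:
--   * independent rows ⇒ every fibre has q^m / q^(Σ d_i) elements (count
--     the pairs (c, v) with c · L_d v = 0 in two ways), giving system ⇒ net;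
--   * every fibre nonempty (L_d onto) ⇒ independent rows, giving net ⇒ system.
-- The admissible intervals (e_i ∣ d_i, volume ≥ q^(u-m)) are exactly the
-- exponent vectors with e_i ∣ d_i and Σ d_i ≤ m - u used by the system.

open import Defs
open import Level using (Level)
open import Algebra.Bundles using (CommutativeRing)
open import Data.Nat using (ℕ; _∸_; _≤_; NonZero)
open import Data.Fin using (Fin)
open import Relation.Binary.PropositionalEquality as ≡ using (_≡_)
open import Function.Bundles using (Bijection; _⇔_)
open import Algebra.Bundles using (Semiring)
open import Function.Bundles using (mk⇔)

-- Flattening a family of index ranges: the index set
-- {(i, j) : i < s, j < d_i} is in bijection with Fin (Σℕ d).
module Flattening where

  open import Data.Nat using (ℕ; zero; suc)
  open import Data.Fin as F using (Fin; splitAt; join; _↑ˡ_; _↑ʳ_)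
  open import Data.Fin.Properties using (splitAt-↑ˡ; splitAt-↑ʳ; join-splitAt)
  open import Data.Sum using (inj₁; inj₂)
  open import Data.Product using (Σ; _,_; proj₁; proj₂)
  open import Relation.Binary.PropositionalEquality
  open import Function using (_∘_)

  ι : ∀ {s} (d : Fin s → ℕ) (i : Fin s) → Fin (d i) → Fin (Σℕ d)
  ι d F.zero    j = j ↑ˡ Σℕ (d ∘ F.suc)
  ι d (F.suc i) j = d F.zero ↑ʳ ι (d ∘ F.suc) i j

  ρ : ∀ {s} (d : Fin s → ℕ) → Fin (Σℕ d) → Σ (Fin s) (Fin ∘ d)
  ρ {suc s} d k with splitAt (d F.zero) k
  ... | inj₁ j  = F.zero , j
  ... | inj₂ k′ = F.suc (proj₁ (ρ (d ∘ F.suc) k′)) , proj₂ (ρ (d ∘ F.suc) k′)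

  ρ-ι : ∀ {s} (d : Fin s → ℕ) i j → ρ d (ι d i j) ≡ (i , j)
  ρ-ι d F.zero j rewrite splitAt-↑ˡ (d F.zero) j (Σℕ (d ∘ F.suc)) = refl
  ρ-ι d (F.suc i) j rewrite splitAt-↑ʳ (d F.zero) (Σℕ (d ∘ F.suc)) (ι (d ∘ F.suc) i j)
                          | ρ-ι (d ∘ F.suc) i j = refl

  ι-ρ : ∀ {s} (d : Fin s → ℕ) k → ι d (proj₁ (ρ d k)) (proj₂ (ρ d k)) ≡ k
  ι-ρ {suc s} d k with splitAt (d F.zero) k in eq
  ... | inj₁ j  = trans (cong (join (d F.zero) _) (sym eq)) (join-splitAt (d F.zero) (Σℕ (d ∘ F.suc)) k)
  ... | inj₂ k′ = trans (cong (d F.zero ↑ʳ_) (ι-ρ (d ∘ F.suc) k′))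
                        (trans (cong (join (d F.zero) _) (sym eq)) (join-splitAt (d F.zero) (Σℕ (d ∘ F.suc)) k))

-- Finite sums.  Defs sums over Fin k (Σℕ, ΣF) by the same recursion as
-- the library's `sum`; this module identifies such an operator with
-- `sum` and transfers the library's summation laws to it.
module RecursiveSum {c ℓ} (R : Semiring c ℓ)
  (S : ∀ {k} → (Fin k → Semiring.Carrier R) → Semiring.Carrier R)
  (S-nil : ∀ f → S {0} f ≡ Semiring.0# R)
  (S-cons : ∀ {k} (f : Fin (Data.Nat.suc k) → Semiring.Carrier R) →
            S f ≡ Semiring._+_ R (f Data.Fin.zero) (S (λ i → f (Data.Fin.suc i)))) where

  open import Data.Nat as N using (zero; suc; z≤n; s≤s)
  open import Data.Fin as Fin using (punchIn; toℕ; inject≤; _↑ˡ_; _↑ʳ_)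
  open import Data.Fin.Properties using (punchInᵢ≢i)
  open Flattening using (ι)
  open import Data.Fin.Permutation using (permutation)
  open import Relation.Binary.PropositionalEquality using (_≢_)
  open import Function using (_∘_)
  open Semiring R
  open import Algebra.Properties.Semiring.Sum R
  open import Relation.Binary.Reasoning.Setoid setoid

  S≡sum : ∀ {k} (f : Fin k → Carrier) → S f ≡ sum f
  S≡sum {zero}  f = S-nil f
  S≡sum {suc k} f = ≡.trans (S-cons f) (≡.cong (f Fin.zero +_) (S≡sum (f ∘ Fin.suc)))

  via-sum : ∀ {k l} {f : Fin k → Carrier} {g : Fin l → Carrier} → sum f ≈ sum g → S f ≈ S g
  via-sum {f = f} {g} e = trans (reflexive (S≡sum f)) (trans e (sym (reflexive (S≡sum g))))

  S-cong : ∀ {k} {f g : Fin k → Carrier} → (∀ i → f i ≈ g i) → S f ≈ S g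
  S-cong f≈g = via-sum (sum-cong-≋ f≈g)

  S-zero : ∀ {k} (f : Fin k → Carrier) → (∀ i → f i ≈ 0#) → S f ≈ 0#
  S-zero {k} f f≈0 = trans (reflexive (S≡sum f)) (trans (sum-cong-≋ f≈0) (sum-replicate-zero k))

  S-distrib : ∀ {k} (f g : Fin k → Carrier) → S (λ i → f i + g i) ≈ S f + S g
  S-distrib f g = trans (reflexive (S≡sum _))
    (trans (∑-distrib-+ f g) (sym (+-cong (reflexive (S≡sum f)) (reflexive (S≡sum g)))))

  S-swap : ∀ {k l} (f : Fin k → Fin l → Carrier) → S (λ i → S (f i)) ≈ S (λ j → S (λ i → f i j))
  S-swap f = begin
    S (λ i → S (f i))              ≈⟨ S-cong (λ i → reflexive (S≡sum (f i))) ⟩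
    S (λ i → sum (f i))            ≈⟨ via-sum (∑-comm f) ⟩
    S (λ j → sum (λ i → f i j))    ≈⟨ S-cong (λ j → sym (reflexive (S≡sum _))) ⟩
    S (λ j → S (λ i → f i j))      ∎

  S-*ˡ : ∀ {k} x (f : Fin k → Carrier) → S (λ i → x * f i) ≈ x * S f
  S-*ˡ x f = trans (reflexive (S≡sum _)) (trans (sym (*-distribˡ-sum x f)) (*-congˡ (reflexive (≡.sym (S≡sum f)))))

  S-*ʳ : ∀ {k} x (f : Fin k → Carrier) → S (λ i → f i * x) ≈ S f * x
  S-*ʳ x f = trans (reflexive (S≡sum _)) (trans (sym (*-distribʳ-sum x f)) (*-congʳ (reflexive (≡.sym (S≡sum f)))))

  S-reindex : ∀ {k} (f : Fin k → Carrier) (σ τ : Fin k → Fin k) →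
              (∀ i → σ (τ i) ≡ i) → (∀ i → τ (σ i) ≡ i) → S (f ∘ σ) ≈ S f
  S-reindex f σ τ στ τσ = via-sum (sym (sum-permute f (permutation σ τ στ τσ)))

  S-single : ∀ {k} (f : Fin k → Carrier) (i₀ : Fin k) → (∀ i → i ≢ i₀ → f i ≈ 0#) → S f ≈ f i₀
  S-single {suc k} f i₀ off = begin
    S f                                ≡⟨ S≡sum f ⟩
    sum f                              ≈⟨ sum-remove {i = i₀} f ⟩
    f i₀ + sum (f ∘ punchIn i₀)        ≈⟨ +-congˡ (sum-cong-≋ (λ j → off (punchIn i₀ j) (punchInᵢ≢i i₀ j))) ⟩
    f i₀ + sum {k} (λ _ → 0#)          ≈⟨ +-congˡ (sum-replicate-zero k) ⟩
    f i₀ + 0#                          ≈⟨ +-identityʳ (f i₀) ⟩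
    f i₀                               ∎

  private
    sum-++ : ∀ a b (g : Fin (a N.+ b) → Carrier) → sum g ≈ sum (λ j → g (j ↑ˡ b)) + sum (λ k → g (a ↑ʳ k))
    sum-++ zero    b g = sym (+-identityˡ _)
    sum-++ (suc a) b g = trans (+-congˡ (sum-++ a b (g ∘ Fin.suc))) (sym (+-assoc _ _ _))

    sum-flatten : ∀ {s} (d : Fin s → ℕ) (g : Fin (Σℕ d) → Carrier) → sum g ≈ sum (λ i → sum (λ j → g (ι d i j)))
    sum-flatten {zero}  d g = refl
    sum-flatten {suc s} d g = trans (sum-++ (d Fin.zero) (Σℕ (d ∘ Fin.suc)) g)
      (+-congˡ (sum-flatten (d ∘ Fin.suc) (λ k → g (d Fin.zero ↑ʳ k))))

  S-flatten : ∀ {s} (d : Fin s → ℕ) (g : Fin (Σℕ d) → Carrier) → S g ≈ S (λ i → S (λ j → g (ι d i j)))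
  S-flatten d g = trans (via-sum (sum-flatten d g)) (S-cong (λ i → sym (reflexive (S≡sum _))))

  S-truncate : ∀ {m} a (a≤m : a ≤ m) (f : Fin m → Carrier) → (∀ j → a ≤ toℕ j → f j ≈ 0#) →
               S f ≈ S (λ j → f (inject≤ j a≤m))
  S-truncate zero a≤m f vanish = trans (S-zero f (λ j → vanish j z≤n)) (sym (reflexive (S-nil _)))
  S-truncate {suc m} (suc a) (s≤s a≤m) f vanish = begin
    S f                                                   ≡⟨ S-cons f ⟩
    f Fin.zero + S (f ∘ Fin.suc)                ≈⟨ +-congˡ (S-truncate a a≤m (f ∘ Fin.suc) (λ j a≤j → vanish (Fin.suc j) (s≤s a≤j))) ⟩
    f Fin.zero + S (λ j → f (Fin.suc (inject≤ j a≤m)))   ≡⟨ S-cons _ ⟨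
    S (λ j → f (inject≤ j (s≤s a≤m)))                     ∎

-- Natural-number sums and counting.  A decidable property P of Fin n is
-- counted by Σℕ of its indicator 𝟙; `countIn` in Defs is such a count.
module Counting where

  open import Data.Nat
  open import Data.Nat.Properties
  open import Data.Fin as F using (Fin)
  open import Data.List using (length; filter; allFin; tabulate)
  open import Data.Product using (∃; _,_)
  open import Data.Empty using (⊥-elim)
  open import Relation.Nullary using (Dec; yes; no; ¬_)
  open import Relation.Unary using (Decidable)
  open import Relation.Binary.PropositionalEquality
  open import Function using (_∘_; id)

  open RecursiveSum +-*-semiring Σℕ (λ _ → refl) (λ _ → refl) using ()
    renaming (S-cong to Σℕ-cong; S-distrib to Σℕ-distrib; S-swap to Σℕ-swap; S-*ˡ to Σℕ-*ˡ;
              S-*ʳ to Σℕ-*ʳ; S-reindex to Σℕ-reindex; S-single to Σℕ-single) public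

  𝟙 : ∀ {p} {P : Set p} → Dec P → ℕ
  𝟙 (yes _) = 1
  𝟙 (no _)  = 0

  𝟙-cong : ∀ {p r} {P : Set p} {Q : Set r} → (P → Q) → (Q → P) → (P? : Dec P) (Q? : Dec Q) → 𝟙 P? ≡ 𝟙 Q?
  𝟙-cong P→Q Q→P (yes _) (yes _) = refl
  𝟙-cong P→Q Q→P (yes p) (no ¬q) = ⊥-elim (¬q (P→Q p))
  𝟙-cong P→Q Q→P (no ¬p) (yes q) = ⊥-elim (¬p (Q→P q))
  𝟙-cong P→Q Q→P (no _)  (no _)  = refl

  𝟙-yes : ∀ {p} {P : Set p} → P → (P? : Dec P) → 𝟙 P? ≡ 1
  𝟙-yes p (yes _) = refl
  𝟙-yes p (no ¬p) = ⊥-elim (¬p p)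

  𝟙-no : ∀ {p} {P : Set p} → ¬ P → (P? : Dec P) → 𝟙 P? ≡ 0
  𝟙-no ¬p (yes p) = ⊥-elim (¬p p)
  𝟙-no ¬p (no _)  = refl

  Σℕ-const : ∀ {n} c → Σℕ {n} (λ _ → c) ≡ n * c
  Σℕ-const {zero}  c = refl
  Σℕ-const {suc n} c = cong (c +_) (Σℕ-const {n} c)

  Σℕ-mono : ∀ {n} {f g : Fin n → ℕ} → (∀ i → f i ≤ g i) → Σℕ f ≤ Σℕ g
  Σℕ-mono {zero}  f≤g = z≤n
  Σℕ-mono {suc n} f≤g = +-mono-≤ (f≤g F.zero) (Σℕ-mono (f≤g ∘ F.suc))

  Σℕ-term≤ : ∀ {n} (f : Fin n → ℕ) i → f i ≤ Σℕ f
  Σℕ-term≤ f F.zero    = m≤m+n (f F.zero) (Σℕ (f ∘ F.suc))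
  Σℕ-term≤ f (F.suc i) = ≤-trans (Σℕ-term≤ (f ∘ F.suc) i) (m≤n+m (Σℕ (f ∘ F.suc)) (f F.zero))

  Σℕ-all-equal : ∀ {n} K (f : Fin n → ℕ) → (∀ i → f i ≤ K) → Σℕ f ≡ n * K → ∀ i → f i ≡ K
  Σℕ-all-equal {suc n} K f f≤K sum≡ = go
    where
      tail≤ : Σℕ (f ∘ F.suc) ≤ n * K
      tail≤ = ≤-trans (Σℕ-mono (f≤K ∘ F.suc)) (≤-reflexive (Σℕ-const {n} K))
      head≡ : f F.zero ≡ K
      head≡ = ≤-antisym (f≤K F.zero)
        (+-cancelʳ-≤ (Σℕ (f ∘ F.suc)) K (f F.zero) (≤-trans (+-monoʳ-≤ K tail≤) (≤-reflexive (sym sum≡))))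
      tail≡ : Σℕ (f ∘ F.suc) ≡ n * K
      tail≡ = +-cancelˡ-≡ K _ _ (trans (cong (_+ Σℕ (f ∘ F.suc)) (sym head≡)) sum≡)
      go : ∀ i → f i ≡ K
      go F.zero    = head≡
      go (F.suc i) = Σℕ-all-equal K (f ∘ F.suc) (f≤K ∘ F.suc) tail≡ i

  count-filter : ∀ {n p} {P : Fin n → Set p} (P? : Decidable P) →
                 length (filter P? (allFin n)) ≡ Σℕ (λ i → 𝟙 (P? i))
  count-filter {n} P? = go n id
    where
      go : ∀ k (g : Fin k → Fin n) → length (filter P? (tabulate g)) ≡ Σℕ (λ i → 𝟙 (P? (g i)))
      go zero    g = refl
      go (suc k) g with P? (g F.zero)
      ... | yes _ = cong suc (go k (g ∘ F.suc))
      ... | no _  = go k (g ∘ F.suc)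

  count-unique : ∀ {n p} {P : Fin n → Set p} (P? : Decidable P) (i₀ : Fin n) →
                 (∀ i → P i → i ≡ i₀) → P i₀ → Σℕ (λ i → 𝟙 (P? i)) ≡ 1
  count-unique P? i₀ unique p₀ =
    trans (Σℕ-single _ i₀ (λ i i≢i₀ → 𝟙-no (i≢i₀ ∘ unique i) (P? i))) (𝟙-yes p₀ (P? i₀))

  count-witness : ∀ {n p} {P : Fin n → Set p} (P? : Decidable P) → 0 < Σℕ (λ i → 𝟙 (P? i)) → ∃ P
  count-witness {suc n} P? pos with P? F.zero
  ... | yes p = F.zero , p
  ... | no _  with count-witness (P? ∘ F.suc) pos
  ...   | i , p = F.suc i , p

-- Base-q digit expansions of the index n of a point.  (Defs indexes the
-- function `digit` by a ring it does not use; R fills that slot.)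
module Digits {c ℓ} (R : CommutativeRing c ℓ) (q : ℕ) .{{q≢0 : NonZero q}} where

  open import Data.Nat
  open import Data.Nat.Properties
  open import Data.Nat.DivMod
  open import Data.Nat.Divisibility using (n∣m*n)
  open import Data.Fin as F using (Fin; toℕ)
  open import Data.Fin.Properties using (toℕ<n; toℕ-injective; toℕ-fromℕ<)
  open import Relation.Binary.PropositionalEquality
  open import Function using (_∘_)

  dig : ℕ → ℕ → Fin q
  dig = digit R q

  littleEndian : ∀ {m} → (Fin m → Fin q) → ℕ
  littleEndian {zero}  δ = 0
  littleEndian {suc m} δ = toℕ (δ F.zero) + littleEndian (δ ∘ F.suc) * q

  littleEndian-cong : ∀ {m} {δ δ′ : Fin m → Fin q} → (∀ k → δ k ≡ δ′ k) → littleEndian δ ≡ littleEndian δ′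
  littleEndian-cong {zero}  _   = refl
  littleEndian-cong {suc m} δ≡δ′ =
    cong₂ (λ a b → toℕ a + b * q) (δ≡δ′ F.zero) (littleEndian-cong (δ≡δ′ ∘ F.suc))

  littleEndian-< : ∀ {m} (δ : Fin m → Fin q) → littleEndian δ < q ^ m
  littleEndian-< {zero}  δ = s≤s z≤n
  littleEndian-< {suc m} δ = begin-strict
    toℕ (δ F.zero) + littleEndian (δ ∘ F.suc) * q  <⟨ +-monoˡ-< _ (toℕ<n (δ F.zero)) ⟩
    suc (littleEndian (δ ∘ F.suc)) * q             ≤⟨ *-monoˡ-≤ q (littleEndian-< (δ ∘ F.suc)) ⟩
    q ^ m * q                                      ≡⟨ *-comm (q ^ m) q ⟩
    q * q ^ m                                      ∎
    where open ≤-Reasoning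

  div-digit : ∀ r k → r < q → (r + k * q) / q ≡ k
  div-digit r k r<q = begin
    (r + k * q) / q    ≡⟨ +-distrib-/-∣ʳ r (n∣m*n k) ⟩
    r / q + k * q / q  ≡⟨ cong₂ _+_ (m<n⇒m/n≡0 r<q) (m*n/n≡m k q) ⟩
    k                  ∎
    where open ≡-Reasoning

  dig-zero : ∀ n → toℕ (dig n 0) ≡ n % q
  dig-zero n = trans (toℕ-fromℕ< _) (cong (_% q) (n/1≡n n))

  dig-suc : ∀ n r → dig n (suc r) ≡ dig (n / q) r
  dig-suc n r = cong (_mod q) (sym (m/n/o≡m/[n*o] n q (q ^ r) {{q≢0}} {{m^n≢0 q r}} {{m^n≢0 q (suc r)}}))

  dig-littleEndian : ∀ {m} (δ : Fin m → Fin q) (k : Fin m) → dig (littleEndian δ) (toℕ k) ≡ δ k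
  dig-littleEndian {suc m} δ F.zero = toℕ-injective (begin
    toℕ (dig (littleEndian δ) 0)                         ≡⟨ dig-zero _ ⟩
    (toℕ (δ F.zero) + littleEndian (δ ∘ F.suc) * q) % q  ≡⟨ [m+kn]%n≡m%n (toℕ (δ F.zero)) (littleEndian (δ ∘ F.suc)) q ⟩
    toℕ (δ F.zero) % q                                   ≡⟨ m<n⇒m%n≡m (toℕ<n (δ F.zero)) ⟩
    toℕ (δ F.zero)                                       ∎)
    where open ≡-Reasoning
  dig-littleEndian {suc m} δ (F.suc k) = begin
    dig (littleEndian δ) (suc (toℕ k))        ≡⟨ dig-suc (littleEndian δ) (toℕ k) ⟩
    dig (littleEndian δ / q) (toℕ k)          ≡⟨ cong (λ n → dig n (toℕ k)) (div-digit _ (littleEndian (δ ∘ F.suc)) (toℕ<n (δ F.zero))) ⟩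
    dig (littleEndian (δ ∘ F.suc)) (toℕ k)    ≡⟨ dig-littleEndian (δ ∘ F.suc) k ⟩
    δ (F.suc k)                               ∎
    where open ≡-Reasoning

  littleEndian-dig : ∀ m n → n < q ^ m → littleEndian {m} (λ k → dig n (toℕ k)) ≡ n
  littleEndian-dig zero    n n<1 = sym (n<1⇒n≡0 n<1)
  littleEndian-dig (suc m) n n<qq^m = begin
    toℕ (dig n 0) + littleEndian {m} (λ k → dig n (suc (toℕ k))) * q
      ≡⟨ cong₂ (λ a b → a + b * q) (dig-zero n) (trans (littleEndian-cong {m} (λ k → dig-suc n (toℕ k)))
           (littleEndian-dig m (n / q) (m<n*o⇒m/o<n (subst (n <_) (*-comm q (q ^ m)) n<qq^m)))) ⟩
    n % q + n / q * q  ≡⟨ sym (m≡m%n+[m/n]*n n q) ⟩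
    n                  ∎
    where open ≡-Reasoning

-- Elementary intervals in one coordinate.  A point with digit string x
-- (digits x_1 … x_m, each < q) has coordinate bigEndian x / q^m; it lies
-- in [a q^-d, (a+1) q^-d) iff its first d digits spell a in base q.
module Intervals (q : ℕ) .{{q≢0 : NonZero q}} where

  open import Data.Nat
  open import Data.Nat.Properties
  open import Data.Nat.DivMod
  open import Data.Nat.Tactic.RingSolver using (solve-∀)
  open import Algebra.Properties.CommutativeSemigroup *-commutativeSemigroup using (x∙yz≈y∙xz)
  open import Data.Fin as F using (Fin; toℕ; fromℕ<; inject≤)
  open import Data.Fin.Properties using (toℕ<n; toℕ-fromℕ<)
  open import Data.Product using (Σ; _×_; _,_; proj₁; proj₂)
  open import Data.Empty using (⊥-elim)
  open import Relation.Binary.PropositionalEquality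
  open import Relation.Binary.Definitions using (tri<; tri≈; tri>)
  open import Function using (_∘_)

  -- q^m times the point with digit string x (as in `digitalNet`)
  bigEndian : ∀ {m} → (Fin m → ℕ) → ℕ
  bigEndian {m} x = Σℕ (λ j → x j * q ^ (m ∸ suc (toℕ j)))

  bigEndian-< : ∀ {m} (x : Fin m → ℕ) → (∀ j → x j < q) → bigEndian x < q ^ m
  bigEndian-< {zero}  x _     = s≤s z≤n
  bigEndian-< {suc m} x x<q = begin-strict
    x F.zero * q ^ m + bigEndian (x ∘ F.suc)  <⟨ +-monoʳ-< _ (bigEndian-< (x ∘ F.suc) (x<q ∘ F.suc)) ⟩
    x F.zero * q ^ m + q ^ m                  ≡⟨ +-comm (x F.zero * q ^ m) (q ^ m) ⟩
    suc (x F.zero) * q ^ m                    ≤⟨ *-monoˡ-≤ (q ^ m) (x<q F.zero) ⟩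
    q * q ^ m                                 ∎
    where open ≤-Reasoning

  bigEndian-onto : ∀ d a → a < q ^ d → Σ (Fin d → Fin q) λ α → bigEndian (toℕ ∘ α) ≡ a
  bigEndian-onto zero    a a<1 = (λ ()) , sym (n<1⇒n≡0 a<1)
  bigEndian-onto (suc d) a a<q^d+1 = α , spells
    where
      instance _ = m^n≢0 q d
      lead< : a / q ^ d < q
      lead< = m<n*o⇒m/o<n a<q^d+1
      rest : Σ (Fin d → Fin q) λ α′ → bigEndian (toℕ ∘ α′) ≡ a % q ^ d
      rest = bigEndian-onto d (a % q ^ d) (m%n<n a (q ^ d))
      α : Fin (suc d) → Fin q
      α F.zero    = fromℕ< lead<
      α (F.suc j) = proj₁ rest j
      spells : bigEndian (toℕ ∘ α) ≡ a
      spells = begin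
        toℕ (fromℕ< lead<) * q ^ d + bigEndian (toℕ ∘ proj₁ rest)
          ≡⟨ cong₂ _+_ (cong (_* q ^ d) (toℕ-fromℕ< lead<)) (proj₂ rest) ⟩
        a / q ^ d * q ^ d + a % q ^ d  ≡⟨ +-comm (a / q ^ d * q ^ d) _ ⟩
        a % q ^ d + a / q ^ d * q ^ d  ≡⟨ sym (m≡m%n+[m/n]*n a (q ^ d)) ⟩
        a                              ∎
        where open ≡-Reasoning

  InElementary : ℕ → ℕ → ℕ → ℕ → Set
  InElementary a X d m = a * q ^ m ≤ X * q ^ d × X * q ^ d < suc a * q ^ m

  *-q^suc : ∀ x k → x * q ^ suc k ≡ q * (x * q ^ k)
  *-q^suc x k = x∙yz≈y∙xz x q (q ^ k)

  inElementary-reduce : ∀ a X d m → InElementary a X (suc d) (suc m) → InElementary a X d m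
  inElementary-reduce a X d m (lo , hi) =
    *-cancelˡ-≤ q (subst₂ _≤_ (*-q^suc a m) (*-q^suc X d) lo) ,
    *-cancelˡ-< q _ _ (subst₂ _<_ (*-q^suc X d) (*-q^suc (suc a) m) hi)

  inElementary-extend : ∀ a X d m → InElementary a X d m → InElementary a X (suc d) (suc m)
  inElementary-extend a X d m (lo , hi) =
    subst₂ _≤_ (sym (*-q^suc a m)) (sym (*-q^suc X d)) (*-monoʳ-≤ q lo) ,
    subst₂ _<_ (sym (*-q^suc X d)) (sym (*-q^suc (suc a) m)) (*-monoʳ-< q hi)

  leading-digit : ∀ Q α x A B Y → B ≤ Q → Y < Q →
                  α * Q + A ≤ x * Q + Y → x * Q + Y < α * Q + B → α ≡ x × A ≤ Y × Y < B
  leading-digit Q α x A B Y B≤Q Y<Q lo hi with <-cmp α x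
  ... | tri≈ _ refl _ = refl , +-cancelˡ-≤ (α * Q) A Y lo , +-cancelˡ-< (α * Q) Y B hi
  ... | tri< α<x _ _ = ⊥-elim (<-irrefl refl (<-≤-trans hi (begin
          α * Q + B  ≤⟨ +-monoʳ-≤ (α * Q) B≤Q ⟩
          α * Q + Q  ≡⟨ +-comm (α * Q) Q ⟩
          suc α * Q  ≤⟨ *-monoˡ-≤ Q α<x ⟩
          x * Q      ≤⟨ m≤m+n (x * Q) Y ⟩
          x * Q + Y  ∎)))
    where open ≤-Reasoning
  ... | tri> _ _ x<α = ⊥-elim (<-irrefl refl (≤-<-trans lo (begin-strict
          x * Q + Y  <⟨ +-monoʳ-< (x * Q) Y<Q ⟩
          x * Q + Q  ≡⟨ +-comm (x * Q) Q ⟩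
          suc x * Q  ≤⟨ *-monoˡ-≤ Q x<α ⟩
          α * Q      ≤⟨ m≤m+n (α * Q) A ⟩
          α * Q + A  ∎)))
    where open ≤-Reasoning

  expand-lo : ∀ h t A B → (h * A + t) * B ≡ h * (A * B) + t * B
  expand-lo = solve-∀
  expand-hi : ∀ h t A B → suc (h * A + t) * B ≡ h * (A * B) + suc t * B
  expand-hi = solve-∀
  expand-swapped : ∀ h t A B → (h * B + t) * A ≡ h * (A * B) + t * A
  expand-swapped = solve-∀

  module _ {d m} (α : Fin (suc d) → Fin q) (x : Fin (suc m) → ℕ) where
    private
      a₀ a′ x₀ X′ Q : ℕ
      a₀ = toℕ (α F.zero)
      a′ = bigEndian (toℕ ∘ α ∘ F.suc)
      x₀ = x F.zero
      X′ = bigEndian (x ∘ F.suc)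
      Q = q ^ d * q ^ m

    inElementary-uncons : (∀ j → x j < q) →
      InElementary (bigEndian (toℕ ∘ α)) (bigEndian x) (suc d) (suc m) →
      a₀ ≡ x₀ × InElementary a′ X′ d m
    inElementary-uncons x<q inside =
      leading-digit Q a₀ x₀ (a′ * q ^ m) (suc a′ * q ^ m) (X′ * q ^ d) a′q^m≤Q X′q^d<Q
        (subst₂ _≤_ (expand-lo a₀ a′ (q ^ d) (q ^ m)) (expand-swapped x₀ X′ (q ^ d) (q ^ m)) (proj₁ reduced))
        (subst₂ _<_ (expand-swapped x₀ X′ (q ^ d) (q ^ m)) (expand-hi a₀ a′ (q ^ d) (q ^ m)) (proj₂ reduced))
      where
        reduced : InElementary (bigEndian (toℕ ∘ α)) (bigEndian x) d m
        reduced = inElementary-reduce (bigEndian (toℕ ∘ α)) (bigEndian x) d m inside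
        a′q^m≤Q : suc a′ * q ^ m ≤ Q
        a′q^m≤Q = *-monoˡ-≤ (q ^ m) (bigEndian-< (toℕ ∘ α ∘ F.suc) (toℕ<n ∘ α ∘ F.suc))
        X′q^d<Q : X′ * q ^ d < Q
        X′q^d<Q = subst (X′ * q ^ d <_) (*-comm (q ^ m) (q ^ d))
                    (*-monoˡ-< (q ^ d) {{m^n≢0 q d}} (bigEndian-< (x ∘ F.suc) (x<q ∘ F.suc)))

    inElementary-cons : a₀ ≡ x₀ → InElementary a′ X′ d m →
      InElementary (bigEndian (toℕ ∘ α)) (bigEndian x) (suc d) (suc m)
    inElementary-cons a₀≡x₀ (lo , hi) = inElementary-extend (bigEndian (toℕ ∘ α)) (bigEndian x) d m
      ( subst₂ _≤_ (sym (expand-lo a₀ a′ (q ^ d) (q ^ m))) X≡ (+-monoʳ-≤ (a₀ * Q) lo)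
      , subst₂ _<_ X≡ (sym (expand-hi a₀ a′ (q ^ d) (q ^ m))) (+-monoʳ-< (a₀ * Q) hi))
      where X≡ : a₀ * Q + X′ * q ^ d ≡ (x₀ * q ^ m + X′) * q ^ d
            X≡ = trans (cong (λ z → z * Q + X′ * q ^ d) a₀≡x₀) (sym (expand-swapped x₀ X′ (q ^ d) (q ^ m)))

  inElementary⇒digits : ∀ {d m} (d≤m : d ≤ m) (α : Fin d → Fin q) (x : Fin m → ℕ) → (∀ j → x j < q) →
    InElementary (bigEndian (toℕ ∘ α)) (bigEndian x) d m → ∀ j → x (inject≤ j d≤m) ≡ toℕ (α j)
  inElementary⇒digits {suc d} {suc m} d≤m α x x<q inside F.zero =
    sym (proj₁ (inElementary-uncons α x x<q inside))
  inElementary⇒digits {suc d} {suc m} (s≤s d≤m) α x x<q inside (F.suc j) =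
    inElementary⇒digits d≤m (α ∘ F.suc) (x ∘ F.suc) (x<q ∘ F.suc) (proj₂ (inElementary-uncons α x x<q inside)) j

  digits⇒inElementary : ∀ {d m} (d≤m : d ≤ m) (α : Fin d → Fin q) (x : Fin m → ℕ) → (∀ j → x j < q) →
    (∀ j → x (inject≤ j d≤m) ≡ toℕ (α j)) → InElementary (bigEndian (toℕ ∘ α)) (bigEndian x) d m
  digits⇒inElementary {zero} {m} d≤m α x x<q _ =
    z≤n , subst (_< 1 * q ^ m) (sym (*-identityʳ (bigEndian x))) (subst (bigEndian x <_) (sym (+-identityʳ _)) (bigEndian-< x x<q))
  digits⇒inElementary {suc d} {suc m} (s≤s d≤m) α x x<q agree =
    inElementary-cons α x (sym (agree F.zero))
      (digits⇒inElementary d≤m (α ∘ F.suc) (x ∘ F.suc) (x<q ∘ F.suc) (agree ∘ F.suc))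

-- Linear algebra over a finite field F with q elements.  Sums of natural numbers over all of F^n are taken
-- through an enumeration Fin (q^n) → F^n built from base-q digits.
module LinearAlgebra {c ℓ} (F : CommutativeRing c ℓ) (isField : IsField F)
                     (q : ℕ) .{{q≢0 : NonZero q}} (card : HasCard F q) where

  open import Data.Nat as N using (suc; zero; _^_; _<_)
  import Data.Nat.Properties as NP
  open import Data.Fin as Fin using (toℕ; fromℕ<; _≟_)
  open import Data.Fin.Properties using (toℕ-fromℕ<; toℕ-injective; toℕ<n; all?; ¬∀⟶∃¬)
  open import Data.Product using (∃; _×_; _,_; proj₁; proj₂)
  open import Data.Empty using (⊥-elim)
  open import Relation.Nullary using (Dec; yes; no; ¬_)
  open import Relation.Nullary.Decidable using (map′)
  open import Relation.Binary.PropositionalEquality using (_≢_)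
  open import Function using (_∘_)
  open import Function.Bundles using (Inverse)
  open import Function.Properties.Bijection using (Bijection⇒Inverse)
  open CommutativeRing F
  open IsField isField
  open Counting
  open Digits F q
  open RecursiveSum semiring (ΣF F) (λ _ → ≡.refl) (λ _ → ≡.refl) using ()
    renaming (S-cong to ΣF-cong; S-zero to ΣF-zero; S-distrib to ΣF-distrib; S-swap to ΣF-swap;
              S-*ˡ to ΣF-*ˡ; S-*ʳ to ΣF-*ʳ; S-single to ΣF-single)
  import Relation.Binary.Reasoning.Setoid as SetoidReasoning

  module Enum (η : Bijection (≡.setoid (Fin q)) setoid) = Inverse (Bijection⇒Inverse η)

  to-from : (η : Bijection (≡.setoid (Fin q)) setoid) → ∀ x → Enum.to η (Enum.from η x) ≈ x
  to-from η x = Enum.inverseˡ η ≡.refl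

  from-to : (η : Bijection (≡.setoid (Fin q)) setoid) → ∀ a → Enum.from η (Enum.to η a) ≡ a
  from-to η a = Enum.inverseʳ η refl

  -- equality in F is decidable, by comparing positions in the enumeration
  _≈?_ : ∀ x y → Dec (x ≈ y)
  x ≈? y = map′ (λ same → trans (sym (to-from card x)) (trans (reflexive (≡.cong (Enum.to card) same)) (to-from card y)))
                (Enum.from-cong card) (Enum.from card x ≟ Enum.from card y)

  -- a field has two distinct elements, so q ≥ 2
  2≤q : 2 N.≤ q
  2≤q = distinct (Enum.from card 0#) (Enum.from card 1#)
                 (λ same → 0≉1 (trans (sym (to-from card 0#)) (trans (reflexive (≡.cong (Enum.to card) same)) (to-from card 1#))))
    where
      distinct : ∀ {n} (i j : Fin n) → i ≢ j → 2 N.≤ n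
      distinct {suc zero} Fin.zero Fin.zero i≢j = ⊥-elim (i≢j ≡.refl)
      distinct {suc (suc n)} _ _ _ = N.s≤s (N.s≤s N.z≤n)

  V : ℕ → Set c
  V n = Fin n → Carrier

  infix 4 _≈ᵥ_
  _≈ᵥ_ : ∀ {n} → V n → V n → Set ℓ
  x ≈ᵥ y = ∀ k → x k ≈ y k

  _≈ᵥ?_ : ∀ {n} (x y : V n) → Dec (x ≈ᵥ y)
  x ≈ᵥ? y = all? (λ k → x k ≈? y k)

  0ᵥ : ∀ {n} → V n
  0ᵥ _ = 0#

  _+ᵥ_ : ∀ {n} → V n → V n → V n
  (x +ᵥ y) k = x k + y k

  dot : ∀ {n} → V n → V n → Carrier
  dot x v = ΣF F (λ k → x k * v k)

  dot-cong : ∀ {n} {x x′ v v′ : V n} → x ≈ᵥ x′ → v ≈ᵥ v′ → dot x v ≈ dot x′ v′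
  dot-cong x≈x′ v≈v′ = ΣF-cong (λ k → *-cong (x≈x′ k) (v≈v′ k))

  dot-comm : ∀ {n} (x y : V n) → dot x y ≈ dot y x
  dot-comm x y = ΣF-cong (λ k → *-comm (x k) (y k))

  dot-+ʳ : ∀ {n} (x v w : V n) → dot x (v +ᵥ w) ≈ dot x v + dot x w
  dot-+ʳ x v w = trans (ΣF-cong (λ k → distribˡ (x k) (v k) (w k))) (ΣF-distrib (λ k → x k * v k) (λ k → x k * w k))

  dot-0ˡ : ∀ {n} (v : V n) → dot 0ᵥ v ≈ 0#
  dot-0ˡ v = ΣF-zero _ (λ k → zeroˡ (v k))

  unit : ∀ {n} → Fin n → Carrier → V n
  unit k₀ a j with j ≟ k₀
  ... | yes _ = a
  ... | no _  = 0#

  unit-at : ∀ {n} (k₀ : Fin n) a → unit k₀ a k₀ ≈ a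
  unit-at k₀ a with k₀ ≟ k₀
  ... | yes _   = refl
  ... | no k₀≢k₀ = ⊥-elim (k₀≢k₀ ≡.refl)

  unit-off : ∀ {n} (k₀ j : Fin n) a → j ≢ k₀ → unit k₀ a j ≈ 0#
  unit-off k₀ j a j≢k₀ with j ≟ k₀
  ... | yes j≡k₀ = ⊥-elim (j≢k₀ j≡k₀)
  ... | no _     = refl

  dot-unit : ∀ {n} (x : V n) k₀ a → dot x (unit k₀ a) ≈ x k₀ * a
  dot-unit x k₀ a = trans (ΣF-single _ k₀ (λ j j≢k₀ → trans (*-congˡ (unit-off k₀ j a j≢k₀)) (zeroʳ (x j))))
                          (*-congˡ (unit-at k₀ a))

  dot-unit-inverse : ∀ {n} (x : V n) k₀ y → x k₀ * y ≈ 1# → ∀ a → dot x (unit k₀ (a * y)) ≈ a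
  dot-unit-inverse x k₀ y x₀y≈1 a = begin
    dot x (unit k₀ (a * y))   ≈⟨ dot-unit x k₀ (a * y) ⟩
    x k₀ * (a * y)            ≈⟨ *-congˡ (*-comm a y) ⟩
    x k₀ * (y * a)            ≈⟨ *-assoc (x k₀) y a ⟨
    (x k₀ * y) * a            ≈⟨ *-congʳ x₀y≈1 ⟩
    1# * a                    ≈⟨ *-identityˡ a ⟩
    a                         ∎
    where open SetoidReasoning setoid

  cancel-+ : ∀ x t → x + t ≈ t → x ≈ 0#
  cancel-+ x t x+t≈t = begin
    x               ≈⟨ sym (+-identityʳ x) ⟩
    x + 0#          ≈⟨ +-congˡ (sym (-‿inverseʳ t)) ⟩
    x + (t + - t)   ≈⟨ sym (+-assoc x t (- t)) ⟩
    (x + t) + - t   ≈⟨ +-congʳ x+t≈t ⟩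
    t + - t         ≈⟨ -‿inverseʳ t ⟩
    0#              ∎
    where open SetoidReasoning setoid

  module Enumeration {n} (η : Fin n → Bijection (≡.setoid (Fin q)) setoid) where

    vec : Fin (q ^ n) → V n
    vec N k = Enum.to (η k) (dig (toℕ N) (toℕ k))

    index : V n → Fin (q ^ n)
    index v = fromℕ< (littleEndian-< (λ k → Enum.from (η k) (v k)))

    vec-index : ∀ v → vec (index v) ≈ᵥ v
    vec-index v k = trans
      (reflexive (≡.cong (Enum.to (η k)) (≡.trans (≡.cong (λ N → dig N (toℕ k)) (toℕ-fromℕ< _))
                                                  (dig-littleEndian (λ k → Enum.from (η k) (v k)) k))))
      (to-from (η k) (v k))

    index-vec : ∀ N → index (vec N) ≡ N
    index-vec N = toℕ-injective (≡.trans (toℕ-fromℕ< _)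
      (≡.trans (littleEndian-cong (λ k → from-to (η k) _)) (littleEndian-dig n (toℕ N) (toℕ<n N))))

    index-cong : ∀ {v w} → v ≈ᵥ w → index v ≡ index w
    index-cong v≈w = toℕ-injective (≡.trans (toℕ-fromℕ< _)
      (≡.trans (littleEndian-cong (λ k → Enum.from-cong (η k) (v≈w k))) (≡.sym (toℕ-fromℕ< _))))

    vec-injective : ∀ {N M} → vec N ≈ᵥ vec M → N ≡ M
    vec-injective {N} {M} same = ≡.trans (≡.sym (index-vec N)) (≡.trans (index-cong same) (index-vec M))

    Σᵥ : (V n → ℕ) → ℕ
    Σᵥ g = Σℕ (λ N → g (vec N))

    Σᵥ-cong : {g h : V n → ℕ} → (∀ v → g v ≡ h v) → Σᵥ g ≡ Σᵥ h
    Σᵥ-cong g≡h = Σℕ-cong (λ N → g≡h (vec N))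

    Σᵥ-translate : (g : V n → ℕ) → (∀ {v w} → v ≈ᵥ w → g v ≡ g w) → ∀ w → Σᵥ (λ v → g (v +ᵥ w)) ≡ Σᵥ g
    Σᵥ-translate g g-cong w = ≡.trans
      (Σℕ-cong (λ N → g-cong (λ k → sym (vec-index (vec N +ᵥ w) k))))
      (Σℕ-reindex (g ∘ vec) (shift w) (shift (-_ ∘ w)) (back w) (back′ w))
      where
        shift : V n → Fin (q ^ n) → Fin (q ^ n)
        shift u N = index (vec N +ᵥ u)
        shift-shift : ∀ u u′ → (∀ k → (u k + u′ k) ≈ 0#) → ∀ N → shift u (shift u′ N) ≡ N
        shift-shift u u′ cancels N = ≡.trans (index-cong (λ k → begin
            vec (shift u′ N) k + u k   ≈⟨ +-congʳ (vec-index (vec N +ᵥ u′) k) ⟩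
            (vec N k + u′ k) + u k     ≈⟨ +-assoc _ _ _ ⟩
            vec N k + (u′ k + u k)     ≈⟨ +-congˡ (trans (+-comm (u′ k) (u k)) (cancels k)) ⟩
            vec N k + 0#               ≈⟨ +-identityʳ _ ⟩
            vec N k                    ∎)) (index-vec N)
          where open SetoidReasoning setoid
        back : ∀ u N → shift u (shift (-_ ∘ u) N) ≡ N
        back u = shift-shift u (-_ ∘ u) (λ k → -‿inverseʳ (u k))
        back′ : ∀ u N → shift (-_ ∘ u) (shift u N) ≡ N
        back′ u = shift-shift (-_ ∘ u) u (λ k → -‿inverseˡ (u k))

    Σᵥ-delta : (x : V n) → Σᵥ (λ v → 𝟙 (v ≈ᵥ? x)) ≡ 1
    Σᵥ-delta x = count-unique (λ N → vec N ≈ᵥ? x) (index x)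
      (λ N same → vec-injective (λ k → trans (same k) (sym (vec-index x k))))
      (vec-index x)

    Σᵥ-const : ∀ a → Σᵥ (λ _ → a) ≡ q ^ n N.* a
    Σᵥ-const a = Σℕ-const {q ^ n} a

  module LinearMap {m D} (η : Fin m → Bijection (≡.setoid (Fin q)) setoid) (R : Fin D → V m) where
    open Enumeration η
    module Target = Enumeration {D} (λ _ → card)

    L : V m → V D
    L v k = dot (R k) v

    Lᵀ : V D → V m
    Lᵀ c j = ΣF F (λ k → c k * R k j)

    dot-L : ∀ c v → dot c (L v) ≈ dot (Lᵀ c) v
    dot-L c v = begin
      ΣF F (λ k → c k * ΣF F (λ j → R k j * v j))       ≈⟨ ΣF-cong (λ k → ΣF-*ˡ (c k) (λ j → R k j * v j)) ⟨
      ΣF F (λ k → ΣF F (λ j → c k * (R k j * v j)))     ≈⟨ ΣF-swap (λ k j → c k * (R k j * v j)) ⟩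
      ΣF F (λ j → ΣF F (λ k → c k * (R k j * v j)))     ≈⟨ ΣF-cong (λ j → ΣF-cong (λ k → *-assoc (c k) (R k j) (v j))) ⟨
      ΣF F (λ j → ΣF F (λ k → (c k * R k j) * v j))     ≈⟨ ΣF-cong (λ j → ΣF-*ʳ (v j) (λ k → c k * R k j)) ⟩
      ΣF F (λ j → Lᵀ c j * v j)                         ∎
      where open SetoidReasoning setoid

    fibre : V D → ℕ
    fibre t = Σᵥ (λ v → 𝟙 (L v ≈ᵥ? t))

    fibre-cong : ∀ {t t′} → t ≈ᵥ t′ → fibre t ≡ fibre t′
    fibre-cong t≈t′ = Σᵥ-cong (λ v → 𝟙-cong (λ eq k → trans (eq k) (t≈t′ k)) (λ eq k → trans (eq k) (sym (t≈t′ k)))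
                                            (L v ≈ᵥ? _) (L v ≈ᵥ? _))

    -- a nonempty fibre is a translate of the kernel
    fibre-translate : ∀ t w → L w ≈ᵥ t → fibre t ≡ fibre 0ᵥ
    fibre-translate t w Lw≈t = ≡.trans
      (≡.sym (Σᵥ-translate (λ v → 𝟙 (L v ≈ᵥ? t)) respects w))
      (Σᵥ-cong (λ v → 𝟙-cong (from-kernel v) (to-kernel v) (L (v +ᵥ w) ≈ᵥ? t) (L v ≈ᵥ? 0ᵥ)))
      where
        respects : ∀ {v v′} → v ≈ᵥ v′ → 𝟙 (L v ≈ᵥ? t) ≡ 𝟙 (L v′ ≈ᵥ? t)
        respects v≈v′ = 𝟙-cong (λ eq k → trans (sym (dot-cong (λ _ → refl) v≈v′)) (eq k))
                               (λ eq k → trans (dot-cong (λ _ → refl) v≈v′) (eq k)) (L _ ≈ᵥ? t) (L _ ≈ᵥ? t)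
        from-kernel : ∀ v → L (v +ᵥ w) ≈ᵥ t → L v ≈ᵥ 0ᵥ
        from-kernel v eq k = cancel-+ (L v k) (t k)
          (trans (+-congˡ (sym (Lw≈t k))) (trans (sym (dot-+ʳ (R k) v w)) (eq k)))
        to-kernel : ∀ v → L v ≈ᵥ 0ᵥ → L (v +ᵥ w) ≈ᵥ t
        to-kernel v eq k = trans (dot-+ʳ (R k) v w) (trans (+-cong (eq k) (Lw≈t k)) (+-identityˡ (t k)))

    fibre≤kernel : ∀ t → fibre t N.≤ fibre 0ᵥ
    fibre≤kernel t with fibre t N.≟ 0
    ... | yes empty = NP.≤-trans (NP.≤-reflexive empty) N.z≤n
    ... | no nonempty with count-witness (λ N → L (vec N) ≈ᵥ? t) (NP.n≢0⇒n>0 nonempty)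
    ...   | N , LN≈t = NP.≤-reflexive (fibre-translate t (vec N) LN≈t)

    fibres-total : Target.Σᵥ fibre ≡ q ^ m
    fibres-total = begin
      Target.Σᵥ fibre                                   ≡⟨ Σℕ-swap (λ M N → 𝟙 (L (vec N) ≈ᵥ? Target.vec M)) ⟩
      Σᵥ (λ v → Target.Σᵥ (λ t → 𝟙 (L v ≈ᵥ? t)))        ≡⟨ Σᵥ-cong (λ v → delta (L v)) ⟩
      Σᵥ (λ _ → 1)                                      ≡⟨ Σᵥ-const 1 ⟩
      q ^ m N.* 1                                       ≡⟨ NP.*-identityʳ _ ⟩
      q ^ m                                             ∎
      where
        open ≡.≡-Reasoning
        delta : ∀ x → Target.Σᵥ (λ t → 𝟙 (x ≈ᵥ? t)) ≡ 1
        delta x = ≡.trans (Target.Σᵥ-cong (λ t → 𝟙-cong (λ eq k → sym (eq k)) (λ eq k → sym (eq k)) (x ≈ᵥ? t) (t ≈ᵥ? x)))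
                          (Target.Σᵥ-delta x)

    -- a linear map onto F^D has linearly independent rows: a relation
    -- Lᵀ c = 0 with c_k₀ ≠ 0 would make the solution of L v = (1/c_k₀) e_k₀
    -- satisfy 1 = c · L v = Lᵀ c · v = 0
    onto⇒independent : (∀ t → ∃ λ v → L v ≈ᵥ t) → ∀ c → (∀ j → Lᵀ c j ≈ 0#) → c ≈ᵥ 0ᵥ
    onto⇒independent onto c Lᵀc≈0 k₀ with c k₀ ≈? 0#
    ... | yes c₀≈0 = c₀≈0
    ... | no c₀≉0 = ⊥-elim (0≉1 (begin
      0#                              ≈⟨ dot-0ˡ v ⟨
      dot 0ᵥ v                        ≈⟨ dot-cong Lᵀc≈0 (λ _ → refl) ⟨
      dot (Lᵀ c) v                    ≈⟨ dot-L c v ⟨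
      dot c (L v)                     ≈⟨ dot-cong (λ _ → refl) Lv≈t ⟩
      dot c (unit k₀ (1# * y))        ≈⟨ dot-unit-inverse c k₀ y c₀y≈1 1# ⟩
      1#                              ∎))
      where
        open SetoidReasoning setoid
        y : Carrier
        y = proj₁ (inverse (c k₀) c₀≉0)
        c₀y≈1 : c k₀ * y ≈ 1#
        c₀y≈1 = proj₂ (inverse (c k₀) c₀≉0)
        v : V m
        v = proj₁ (onto (unit k₀ (1# * y)))
        Lv≈t : L v ≈ᵥ unit k₀ (1# * y)
        Lv≈t = proj₂ (onto (unit k₀ (1# * y)))

  -- q = 1 + (q - 1), with q - 1 > 0 since q ≥ 2
  q≡1+[q∸1] : q ≡ suc (q ∸ 1)
  q≡1+[q∸1] = ≡.sym (NP.m+[n∸m]≡n (NP.≤-trans (N.s≤s N.z≤n) 2≤q))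

  kernel-count : ∀ {n} (η : Fin n → Bijection (≡.setoid (Fin q)) setoid) (x : V n) →
    q N.* Enumeration.Σᵥ η (λ v → 𝟙 (dot x v ≈? 0#)) ≡ q ^ n N.+ 𝟙 (x ≈ᵥ? 0ᵥ) N.* ((q ∸ 1) N.* q ^ n)
  kernel-count {n} η x with x ≈ᵥ? 0ᵥ
  ... | yes x≈0 = begin
    q N.* Σᵥ (λ v → 𝟙 (dot x v ≈? 0#))      ≡⟨ ≡.cong (q N.*_) (≡.trans (Σᵥ-cong all-counted) (Σᵥ-const 1)) ⟩
    q N.* (q ^ n N.* 1)                       ≡⟨ ≡.cong₂ N._*_ q≡1+[q∸1] (NP.*-identityʳ (q ^ n)) ⟩
    suc (q ∸ 1) N.* q ^ n                     ≡⟨ ≡.cong (q ^ n N.+_) (≡.sym (NP.*-identityˡ _)) ⟩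
    q ^ n N.+ 1 N.* ((q ∸ 1) N.* q ^ n)      ∎
    where
      open Enumeration η
      open ≡.≡-Reasoning
      all-counted : ∀ v → 𝟙 (dot x v ≈? 0#) ≡ 1
      all-counted v = 𝟙-yes (trans (dot-cong x≈0 (λ _ → refl)) (dot-0ˡ v)) (dot x v ≈? 0#)
  ... | no x≉0 = begin
    q N.* Σᵥ (λ v → 𝟙 (dot x v ≈? 0#))      ≡⟨ ≡.cong (q N.*_) (≡.sym kernel≡) ⟩
    q N.* fibre 0ᵥ                            ≡⟨ ≡.cong (N._* fibre 0ᵥ) (≡.sym (NP.*-identityʳ q)) ⟩
    q ^ 1 N.* fibre 0ᵥ                        ≡⟨ ≡.sym (Target.Σᵥ-const (fibre 0ᵥ)) ⟩
    Target.Σᵥ (λ _ → fibre 0ᵥ)                ≡⟨ Target.Σᵥ-cong (λ t → ≡.sym (fibre-translate t (solution t) (solves t))) ⟩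
    Target.Σᵥ fibre                           ≡⟨ fibres-total ⟩
    q ^ n                                     ≡⟨ NP.+-identityʳ (q ^ n) ⟨
    q ^ n N.+ 0                               ∎
    where
      open Enumeration η
      open LinearMap {D = 1} η (λ _ → x)
      open ≡.≡-Reasoning
      nonzero : ∃ λ k → ¬ (x k ≈ 0#)
      nonzero = ¬∀⟶∃¬ n (λ k → x k ≈ 0#) (λ k → x k ≈? 0#) x≉0
      k₀ : Fin n
      k₀ = proj₁ nonzero
      y : Carrier
      y = proj₁ (inverse (x k₀) (proj₂ nonzero))
      solution : V 1 → V n
      solution t = unit k₀ (t Fin.zero * y)
      solves : ∀ t → L (solution t) ≈ᵥ t
      solves t Fin.zero = dot-unit-inverse x k₀ y (proj₂ (inverse (x k₀) (proj₂ nonzero))) (t Fin.zero)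
      kernel≡ : fibre 0ᵥ ≡ Σᵥ (λ v → 𝟙 (dot x v ≈? 0#))
      kernel≡ = Σᵥ-cong (λ v → 𝟙-cong (λ eq → eq Fin.zero) (λ { eq Fin.zero → eq }) (L v ≈ᵥ? 0ᵥ) (dot x v ≈? 0#))

  summed-kernel-count : ∀ {k n} (ηk : Fin k → Bijection (≡.setoid (Fin q)) setoid)
    (ηn : Fin n → Bijection (≡.setoid (Fin q)) setoid) (X : V k → V n) →
    q N.* Enumeration.Σᵥ ηk (λ u → Enumeration.Σᵥ ηn (λ v → 𝟙 (dot (X u) v ≈? 0#)))
      ≡ q ^ k N.* q ^ n N.+ Enumeration.Σᵥ ηk (λ u → 𝟙 (X u ≈ᵥ? 0ᵥ)) N.* ((q ∸ 1) N.* q ^ n)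
  summed-kernel-count {k} {n} ηk ηn X = begin
    q N.* Σᵥ (λ u → Σᵥ′ (λ v → 𝟙 (dot (X u) v ≈? 0#)))
      ≡⟨ Σℕ-*ˡ q (λ N → Σᵥ′ (λ v → 𝟙 (dot (X (vec N)) v ≈? 0#))) ⟨
    Σᵥ (λ u → q N.* Σᵥ′ (λ v → 𝟙 (dot (X u) v ≈? 0#)))
      ≡⟨ Σᵥ-cong (λ u → kernel-count ηn (X u)) ⟩
    Σᵥ (λ u → q ^ n N.+ 𝟙 (X u ≈ᵥ? 0ᵥ) N.* A)
      ≡⟨ Σℕ-distrib (λ _ → q ^ n) (λ N → 𝟙 (X (vec N) ≈ᵥ? 0ᵥ) N.* A) ⟩
    Σᵥ (λ _ → q ^ n) N.+ Σᵥ (λ u → 𝟙 (X u ≈ᵥ? 0ᵥ) N.* A)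
      ≡⟨ ≡.cong₂ N._+_ (Σᵥ-const (q ^ n)) (Σℕ-*ʳ A (λ N → 𝟙 (X (vec N) ≈ᵥ? 0ᵥ))) ⟩
    q ^ k N.* q ^ n N.+ Σᵥ (λ u → 𝟙 (X u ≈ᵥ? 0ᵥ)) N.* A
      ∎
    where
      open Enumeration ηk
      open Enumeration ηn using () renaming (Σᵥ to Σᵥ′)
      open ≡.≡-Reasoning
      A : ℕ
      A = (q ∸ 1) N.* q ^ n

  -- The size K
  -- of the kernel is found by counting the pairs (c, v) ∈ F^D × F^m with
  -- c · L v = 0 in two ways; then every fibre is a translate of the
  -- kernel or empty, and since the fibres partition F^m none is empty.
  module IndependentRows {m D} (η : Fin m → Bijection (≡.setoid (Fin q)) setoid) (R : Fin D → V m)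
    (independent : ∀ c → (∀ j → ΣF F (λ k → c k * R k j) ≈ 0#) → c ≈ᵥ 0ᵥ) where
    open LinearMap η R
    open Enumeration η

    private
      K : ℕ
      K = fibre 0ᵥ
      pairs : ℕ
      pairs = Target.Σᵥ (λ c → Σᵥ (λ v → 𝟙 (dot (Lᵀ c) v ≈? 0#)))

    -- the same pairs, with v as the outer variable (c · L v = Lᵀ c · v)
    pairs-by-v : pairs ≡ Σᵥ (λ v → Target.Σᵥ (λ c → 𝟙 (dot (L v) c ≈? 0#)))
    pairs-by-v = ≡.trans (Σℕ-swap (λ M N → 𝟙 (dot (Lᵀ (Target.vec M)) (vec N) ≈? 0#)))
      (Σᵥ-cong (λ v → Target.Σᵥ-cong (λ c → 𝟙-cong
        (λ eq → trans (trans (dot-comm (L v) c) (dot-L c v)) eq)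
        (λ eq → trans (sym (trans (dot-comm (L v) c) (dot-L c v))) eq)
        (dot (Lᵀ c) v ≈? 0#) (dot (L v) c ≈? 0#))))

    trivial-kernelᵀ : Target.Σᵥ (λ c → 𝟙 (Lᵀ c ≈ᵥ? 0ᵥ)) ≡ 1
    trivial-kernelᵀ = ≡.trans
      (Target.Σᵥ-cong (λ c → 𝟙-cong (independent c) (λ c≈0 j → ΣF-zero (λ k → c k * R k j) (λ k → trans (*-congʳ (c≈0 k)) (zeroˡ _)))
                                    (Lᵀ c ≈ᵥ? 0ᵥ) (c ≈ᵥ? 0ᵥ)))
      (Target.Σᵥ-delta 0ᵥ)

    -- Counting the pairs by c (only c = 0 sees all of F^m) and by v (only
    -- v in the kernel sees all of F^D) gives q^D q^m + (q-1) q^m = q^D q^m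
    -- + K (q-1) q^D; cancelling, K q^D = q^m.
    kernel-size : q ^ m ≡ K N.* q ^ D
    kernel-size = NP.*-cancelˡ-≡ (q ^ m) (K N.* q ^ D) (q ∸ 1) {{N.>-nonZero 0<q∸1}} (begin
      (q ∸ 1) N.* q ^ m                    ≡⟨ NP.*-identityˡ _ ⟨
      1 N.* ((q ∸ 1) N.* q ^ m)            ≡⟨ NP.+-cancelˡ-≡ (q ^ D N.* q ^ m) _ _ two-counts ⟩
      K N.* ((q ∸ 1) N.* q ^ D)            ≡⟨ x∙yz≈y∙xz K (q ∸ 1) (q ^ D) ⟩
      (q ∸ 1) N.* (K N.* q ^ D)            ∎)
      where
        open ≡.≡-Reasoning
        open import Algebra.Properties.CommutativeSemigroup NP.*-commutativeSemigroup using (x∙yz≈y∙xz)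
        0<q∸1 : 0 < q ∸ 1
        0<q∸1 = NP.≤-pred (≡.subst (2 N.≤_) q≡1+[q∸1] 2≤q)
        two-counts : q ^ D N.* q ^ m N.+ 1 N.* ((q ∸ 1) N.* q ^ m) ≡ q ^ D N.* q ^ m N.+ K N.* ((q ∸ 1) N.* q ^ D)
        two-counts = begin
          q ^ D N.* q ^ m N.+ 1 N.* ((q ∸ 1) N.* q ^ m)
            ≡⟨ ≡.cong (λ n → q ^ D N.* q ^ m N.+ n N.* _) trivial-kernelᵀ ⟨
          q ^ D N.* q ^ m N.+ Target.Σᵥ (λ c → 𝟙 (Lᵀ c ≈ᵥ? 0ᵥ)) N.* ((q ∸ 1) N.* q ^ m)
            ≡⟨ summed-kernel-count (λ _ → card) η Lᵀ ⟨
          q N.* pairs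
            ≡⟨ ≡.cong (q N.*_) pairs-by-v ⟩
          q N.* Σᵥ (λ v → Target.Σᵥ (λ c → 𝟙 (dot (L v) c ≈? 0#)))
            ≡⟨ summed-kernel-count η (λ _ → card) L ⟩
          q ^ m N.* q ^ D N.+ K N.* ((q ∸ 1) N.* q ^ D)
            ≡⟨ ≡.cong (N._+ K N.* ((q ∸ 1) N.* q ^ D)) (NP.*-comm (q ^ m) (q ^ D)) ⟩
          q ^ D N.* q ^ m N.+ K N.* ((q ∸ 1) N.* q ^ D)
            ∎

    -- the q^D fibres are each at most K and sum to q^m = q^D K, so all equal K
    fibre-size : ∀ t → fibre t N.* q ^ D ≡ q ^ m
    fibre-size t = ≡.trans (≡.cong (N._* q ^ D) (≡.trans (fibre-cong (λ k → sym (Target.vec-index t k))) (all-K (Target.index t))))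
                           (≡.sym kernel-size)
      where
        all-K : ∀ M → fibre (Target.vec M) ≡ K
        all-K = Σℕ-all-equal K (fibre ∘ Target.vec) (fibre≤kernel ∘ Target.vec)
                  (≡.trans fibres-total (≡.trans kernel-size (NP.*-comm K (q ^ D))))

-- The digital net with generating matrices C_1, …, C_s.  For exponents d
-- with d_i ≤ m and digit strings α_i of length d_i, the n-th point lies in
-- the elementary interval spelled by α iff the vector v of (η-images of)
-- digits of n solves the linear system  c^(i)_j · v = κ_{i,j}^{-1}(α_{i,j}),
-- j < d_i, whose rows are the first d_i rows of each C_i.
module DigitalNet {c ℓ} (F : CommutativeRing c ℓ) (isField : IsField F)
  (q : ℕ) .{{q≢0 : NonZero q}} (card : HasCard F q) (m s : ℕ)
  (C : Fin s → Fin m → Fin m → CommutativeRing.Carrier F)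
  (η : Fin m → Bijection (≡.setoid (Fin q)) (CommutativeRing.setoid F))
  (κ : Fin s → Fin m → Bijection (CommutativeRing.setoid F) (≡.setoid (Fin q))) where

  open import Data.Nat as N using (suc; zero; _^_; _<_)
  import Data.Nat.Properties as NP
  open import Data.Fin as Fin using (toℕ; fromℕ<; inject≤)
  open import Data.Fin.Properties using (toℕ-fromℕ<; toℕ-injective; toℕ<n; toℕ-inject≤; all?)
  open import Data.Product using (Σ; ∃; _×_; _,_; proj₁; proj₂)
  open import Data.Empty using (⊥-elim)
  open import Relation.Nullary using (Dec; yes; no)
  open import Relation.Nullary.Decidable using (_×-dec_)
  open import Function using (_∘_)
  open import Function.Bundles using (Inverse)
  open import Function.Properties.Bijection using (Bijection⇒Inverse)
  open CommutativeRing F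
  open LinearAlgebra F isField q card
  open Enumeration η
  open Intervals q
  open Counting
  open Flattening
  open RecursiveSum semiring (ΣF F) (λ _ → ≡.refl) (λ _ → ≡.refl)
    using () renaming (S-cong to ΣF-cong; S-flatten to ΣF-flatten; S-truncate to ΣF-truncate)
  import Relation.Binary.Reasoning.Setoid as SetoidReasoning

  -- the points, scaled by q^m
  P : Fin (q ^ m) → Fin s → ℕ
  P = digitalNet F q m s C η κ

  -- the field element y^(i)_j of the N-th point, before κ_{i,j} turns it into a digit
  y : Fin s → Fin m → Fin (q ^ m) → Carrier
  y i j N = dot (C i j) (vec N)

  module Digit (i : Fin s) (j : Fin m) = Inverse (Bijection⇒Inverse (κ i j))

  module Equations (d : Fin s → ℕ) (d≤m : ∀ i → d i ≤ m) where

    D : ℕ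
    D = Σℕ d

    inj : ∀ i → Fin (d i) → Fin m
    inj i j = inject≤ j (d≤m i)

    row : Σ (Fin s) (Fin ∘ d) → V m
    row p = C (proj₁ p) (inj (proj₁ p) (proj₂ p))

    R : Fin D → V m
    R k = row (ρ d k)

    open LinearMap η R public

    rhs : ((i : Fin s) → Fin (d i) → Fin q) → Σ (Fin s) (Fin ∘ d) → Carrier
    rhs α p = Digit.from (proj₁ p) (inj (proj₁ p) (proj₂ p)) (α (proj₁ p) (proj₂ p))

    target : ((i : Fin s) → Fin (d i) → Fin q) → V D
    target α k = rhs α (ρ d k)

    inInterval? : ∀ a N → Dec (InInterval q m s P d a N)
    inInterval? a N = all? (λ i → (a i N.* q ^ m NP.≤? P N i N.* q ^ d i) ×-dec (P N i N.* q ^ d i NP.<? suc (a i) N.* q ^ m))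

    solves-pairs : ∀ α N → L (vec N) ≈ᵥ target α → ∀ i j → y i (inj i j) N ≈ rhs α (i , j)
    solves-pairs α N sol i j = ≡.subst (λ p → dot (row p) (vec N) ≈ rhs α p) (ρ-ι d i j) (sol (ι d i j))

    digitsOf : V D → (i : Fin s) → Fin (d i) → Fin q
    digitsOf t i j = Bijection.to (κ i (inj i j)) (t (ι d i j))

    target-digitsOf : ∀ t → target (digitsOf t) ≈ᵥ t
    target-digitsOf t k = trans (Digit.inverseʳ (proj₁ (ρ d k)) _ ≡.refl) (reflexive (≡.cong t (ι-ρ d k)))

    module Interval (α : (i : Fin s) → Fin (d i) → Fin q) (a : Fin s → ℕ)
                    (spells : ∀ i → bigEndian (toℕ ∘ α i) ≡ a i) where

      digits : Fin (q ^ m) → Fin s → Fin m → ℕ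
      digits N i j = toℕ (Bijection.to (κ i j) (y i j N))

      inInterval⇒solves : ∀ N → InInterval q m s P d a N → L (vec N) ≈ᵥ target α
      inInterval⇒solves N inside k = digit⇒value (proj₁ (ρ d k)) (proj₂ (ρ d k))
        where
          digit⇒value : ∀ i j → y i (inj i j) N ≈ rhs α (i , j)
          digit⇒value i j = sym (Digit.inverseʳ i (inj i j) (≡.sym (toℕ-injective
            (inElementary⇒digits (d≤m i) (α i) (digits N i) (λ _ → toℕ<n _)
              (≡.subst (λ z → InElementary z (P N i) (d i) m) (≡.sym (spells i)) (inside i)) j))))

      solves⇒inInterval : ∀ N → L (vec N) ≈ᵥ target α → InInterval q m s P d a N
      solves⇒inInterval N sol i = ≡.subst (λ z → InElementary z (P N i) (d i) m) (spells i)
        (digits⇒inElementary (d≤m i) (α i) (digits N i) (λ _ → toℕ<n _)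
          (λ j → ≡.cong toℕ (Digit.inverseˡ i (inj i j) (solves-pairs α N sol i j))))

      count≡fibre : countIn q m s P d a ≡ fibre (target α)
      count≡fibre = ≡.trans (count-filter (inInterval? a))
        (Σℕ-cong (λ N → 𝟙-cong (inInterval⇒solves N) (solves⇒inInterval N) (inInterval? a N) (L (vec N) ≈ᵥ? target α)))

    SystemIndependent : Set (c Level.⊔ ℓ)
    SystemIndependent = (coef : Fin s → Fin m → Carrier) → (∀ i j → d i ≤ toℕ j → coef i j ≈ 0#) →
      (∀ k → ΣF F (λ i → ΣF F (λ j → coef i j * C i j k)) ≈ 0#) → ∀ i j → toℕ j < d i → coef i j ≈ 0#

    RowsIndependent : Set (c Level.⊔ ℓ)
    RowsIndependent = ∀ c → (∀ j → Lᵀ c j ≈ 0#) → c ≈ᵥ 0ᵥ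

    -- coefficient families supported on {j < d_i} correspond to vectors in F^D
    flatten : (Fin s → Fin m → Carrier) → V D
    flatten coef k = coef (proj₁ (ρ d k)) (inj (proj₁ (ρ d k)) (proj₂ (ρ d k)))

    spread : V D → Fin s → Fin m → Carrier
    spread c i j with toℕ j NP.<? d i
    ... | yes j<d = c (ι d i (fromℕ< j<d))
    ... | no _    = 0#

    inj< : ∀ i j → toℕ (inj i j) < d i
    inj< i j = ≡.subst (_< d i) (≡.sym (toℕ-inject≤ j (d≤m i))) (toℕ<n j)

    spread-supported : ∀ c i j → d i ≤ toℕ j → spread c i j ≈ 0#
    spread-supported c i j d≤j with toℕ j NP.<? d i
    ... | yes j<d = ⊥-elim (NP.<⇒≱ j<d d≤j)
    ... | no _    = refl

    spread-inj : ∀ c i j → spread c i (inj i j) ≈ c (ι d i j)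
    spread-inj c i j with toℕ (inj i j) NP.<? d i
    ... | yes j<d = reflexive (≡.cong (c ∘ ι d i) (toℕ-injective (≡.trans (toℕ-fromℕ< j<d) (toℕ-inject≤ j (d≤m i)))))
    ... | no j≮d  = ⊥-elim (j≮d (inj< i j))

    flatten-spread : ∀ c → flatten (spread c) ≈ᵥ c
    flatten-spread c k = trans (spread-inj c (proj₁ (ρ d k)) (proj₂ (ρ d k))) (reflexive (≡.cong c (ι-ρ d k)))

    combination-flatten : ∀ coef → (∀ i j → d i ≤ toℕ j → coef i j ≈ 0#) →
      ∀ col → ΣF F (λ i → ΣF F (λ j → coef i j * C i j col)) ≈ Lᵀ (flatten coef) col
    combination-flatten coef supported col = begin
      ΣF F (λ i → ΣF F (λ j → coef i j * C i j col))
        ≈⟨ ΣF-cong (λ i → ΣF-truncate (d i) (d≤m i) _ (λ j d≤j → trans (*-congʳ (supported i j d≤j)) (zeroˡ _))) ⟩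
      ΣF F (λ i → ΣF F (λ j → term (i , j)))
        ≈⟨ ΣF-cong (λ i → ΣF-cong (λ j → reflexive (≡.cong term (≡.sym (ρ-ι d i j))))) ⟩
      ΣF F (λ i → ΣF F (λ j → term (ρ d (ι d i j))))
        ≈⟨ ΣF-flatten d (term ∘ ρ d) ⟨
      Lᵀ (flatten coef) col
        ∎
      where
        open SetoidReasoning setoid
        term : Σ (Fin s) (Fin ∘ d) → Carrier
        term p = coef (proj₁ p) (inj (proj₁ p) (proj₂ p)) * row p col

    system⇒rows : SystemIndependent → RowsIndependent
    system⇒rows system c Lᵀc≈0 k = begin
      c k                                       ≡⟨ ≡.cong c (ι-ρ d k) ⟨
      c (ι d i j)                               ≈⟨ spread-inj c i j ⟨
      spread c i (inj i j)                      ≈⟨ system (spread c) (spread-supported c) vanishes i (inj i j) (inj< i j) ⟩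
      0#                                        ∎
      where
        open SetoidReasoning setoid
        i : Fin s
        i = proj₁ (ρ d k)
        j : Fin (d i)
        j = proj₂ (ρ d k)
        vanishes : ∀ col → ΣF F (λ i → ΣF F (λ j → spread c i j * C i j col)) ≈ 0#
        vanishes col = trans (combination-flatten (spread c) (spread-supported c) col)
                             (trans (ΣF-cong (λ k → *-congʳ (flatten-spread c k))) (Lᵀc≈0 col))

    rows⇒system : RowsIndependent → SystemIndependent
    rows⇒system independent coef supported vanishes i j j<d = begin
      coef i j                                  ≡⟨ ≡.cong (coef i) j≡ ⟨
      coef i (inj i j′)                         ≡⟨ ≡.cong (λ p → coef (proj₁ p) (inj (proj₁ p) (proj₂ p))) (ρ-ι d i j′) ⟨
      flatten coef (ι d i j′)                   ≈⟨ independent (flatten coef) Lᵀ≈0 (ι d i j′) ⟩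
      0#                                        ∎
      where
        open SetoidReasoning setoid
        j′ : Fin (d i)
        j′ = fromℕ< j<d
        j≡ : inj i j′ ≡ j
        j≡ = toℕ-injective (≡.trans (toℕ-inject≤ j′ (d≤m i)) (toℕ-fromℕ< j<d))
        Lᵀ≈0 : ∀ col → Lᵀ (flatten coef) col ≈ 0#
        Lᵀ≈0 col = trans (sym (combination-flatten coef supported col)) (vanishes col)

  volume⇒ : ∀ u D → q ^ (u N.+ D) N.≤ q ^ m → D N.≤ m ∸ u
  volume⇒ u D q^[u+D]≤q^m = NP.≤-trans (NP.≤-reflexive (≡.sym (NP.m+n∸m≡n u D))) (NP.∸-monoˡ-≤ u u+D≤m)
    where
      u+D≤m : u N.+ D N.≤ m
      u+D≤m = NP.≮⇒≥ (λ m<u+D → NP.<⇒≱ (NP.^-monoʳ-< q 2≤q m<u+D) q^[u+D]≤q^m)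

  volume⇐ : ∀ u D → u N.≤ m → D N.≤ m ∸ u → q ^ (u N.+ D) N.≤ q ^ m
  volume⇐ u D u≤m D≤m∸u = NP.^-monoʳ-≤ q (NP.≤-trans (NP.+-monoʳ-≤ u D≤m∸u) (NP.≤-reflexive (NP.m+[n∸m]≡n u≤m)))

  component≤m : ∀ u (d : Fin s → ℕ) → Σℕ d N.≤ m ∸ u → ∀ i → d i N.≤ m
  component≤m u d Σd≤m∸u i = NP.≤-trans (Σℕ-term≤ d i) (NP.≤-trans Σd≤m∸u (NP.m∸n≤m m u))

  -- A system makes every admissible interval's equations independent, so
  -- each interval holds exactly q^m / q^(Σ d) points.
  system⇒net : ∀ u e → IsSystem F (m ∸ u) m s e C → IsNet q m s u e P
  system⇒net u e system d a a<q^d e∣d volume = begin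
    countIn q m s P d a N.* q ^ D   ≡⟨ ≡.cong (N._* q ^ D) count≡fibre ⟩
    fibre (target α) N.* q ^ D      ≡⟨ fibre-size (target α) ⟩
    q ^ m                           ∎
    where
      open ≡.≡-Reasoning
      Σd≤m∸u : Σℕ d N.≤ m ∸ u
      Σd≤m∸u = volume⇒ u (Σℕ d) volume
      open Equations d (component≤m u d Σd≤m∸u)
      α : (i : Fin s) → Fin (d i) → Fin q
      α i = proj₁ (bigEndian-onto (d i) (a i) (a<q^d i))
      open Interval α a (λ i → proj₂ (bigEndian-onto (d i) (a i) (a<q^d i)))
      open IndependentRows η R (system⇒rows (system d e∣d Σd≤m∸u))

  -- Conversely, in a net every admissible system of equations is solvable
  -- (its interval holds q^m / q^D > 0 points), so its rows are independent.
  net⇒system : ∀ u e → u N.≤ m → IsNet q m s u e P → IsSystem F (m ∸ u) m s e C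
  net⇒system u e u≤m net d e∣d Σd≤m∸u = rows⇒system (onto⇒independent onto)
    where
      open Equations d (component≤m u d Σd≤m∸u)
      positive : ∀ x y → x N.* y ≡ q ^ m → 0 < x
      positive zero    y 0≡q^m = ⊥-elim (NP.<⇒≢ (NP.m^n>0 q m) 0≡q^m)
      positive (suc x) y _     = N.s≤s N.z≤n
      onto : ∀ t → ∃ λ v → L v ≈ᵥ t
      onto t = vec N , λ k → trans (inInterval⇒solves N inside k) (target-digitsOf t k)
        where
          α : (i : Fin s) → Fin (d i) → Fin q
          α = digitsOf t
          a : Fin s → ℕ
          a i = bigEndian (toℕ ∘ α i)
          open Interval α a (λ _ → ≡.refl)
          counted : countIn q m s P d a N.* q ^ D ≡ q ^ m
          counted = net d a (λ i → bigEndian-< (toℕ ∘ α i) (λ j → toℕ<n (α i j))) e∣d (volume⇐ u D u≤m Σd≤m∸u)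
          witness : ∃ (InInterval q m s P d a)
          witness = count-witness (inInterval? a)
            (positive _ (q ^ D) (≡.trans (≡.cong (N._* q ^ D) (≡.sym (count-filter (inInterval? a)))) counted))
          N : Fin (q ^ m)
          N = proj₁ witness
          inside : InInterval q m s P d a N
          inside = proj₂ witness

lemma1 : ∀ {c ℓ : Level} (q m s u : ℕ) .{{_ : NonZero q}} →
    IsPrimePower q →
    (F : CommutativeRing c ℓ) → IsField F → HasCard F q →
    1 ≤ m → 1 ≤ s → u ≤ m →
    (e : Fin s → ℕ) → (∀ i → 1 ≤ e i) →
    (C : Fin s → Fin m → Fin m → CommutativeRing.Carrier F) →
    (η : Fin m → Bijection (≡.setoid (Fin q)) (CommutativeRing.setoid F)) →
    (κ : Fin s → Fin m → Bijection (CommutativeRing.setoid F) (≡.setoid (Fin q))) →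
    IsNet q m s u e (digitalNet F q m s C η κ) ⇔ IsSystem F (m ∸ u) m s e C
lemma1 q m s u _ F isField card _ _ u≤m e _ C η κ =
  mk⇔ (net⇒system u e u≤m) (system⇒net u e)
  where open DigitalNet F isField q card m s C η κ
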